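{- Let $\mathcal P=(Q,T)$ be a parameterized system with distinguished initial local state $q_0\in Q$, and let $\Phi_{\mathcal P}$ be its first-order encoding (described in the context). If a configuration $\bar c$ is reachable in $\mathcal P$, i.e. $\bar c_0\to_{\mathcal P}^{*}\bar c$ for some $\bar c_0\in q_0^{*}$, then $\Phi_{\mathcal P}\vdash R(t_{\bar c})$.
   Context: A parameterized system is a pair $\mathcal P=(Q,T)$ of a finite set $Q$ of local states and a finite set $T$ of rules of the form $q\to q'$ or $\mathcal G: q\to q'$ ($q,q'\in Q$), with $\mathcal G$ a condition $\forall_I J$ or $\exists_I J$, $J\subseteq Q$, $I\in\{L,R,LR\}$. A configuration is a word $\bar c=c_1\cdots c_n\in Q^*$. For a position $i$: $(\bar c,i)\models\forall_L J$ iff $c_k\in J$ for all $k<i$; $\forall_R J$ iff $c_k\in J$ for all $k>i$; $\forall_{LR}J$ iff both; $\exists_L J$ iff $c_k\in J$ for some $k<i$; $\exists_R J$ iff $c_k\in J$ for some $k>i$; $\exists_{LR}J$ iff $\exists_L J$ or $\exists_R J$. $\bar c\to_{\mathcal P}\bar c'$ iff for some position $i$ and either a rule $q\to q'$ in $T$, or a rule $\mathcal G:q\to q'$ in $T$ with $(\bar c,i)\models\mathcal G$, we have $c_i=q$, $c'_i=q'$, and $c'_j=c_j$ for $j\ne i$. Encoding: vocabulary has a constant for each $q\in Q$, an extra constant $e\notin Q$, a binary function symbol $*$, unary relations $In$, $R$, and a unary relation $P^J$ for each condition $\forall_I J$ occurring in $T$. For $\bar c=c_1\cdots c_n$, $t_{\bar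 c}=c_1*\cdots*c_n$ (modulo associativity; $e$ for the empty word). $\Phi_{\mathcal P}$ is the set of universal closures of: $(x*y)*z=x*(y*z)$, $e*x=x$, $x*e=x$; $In(e)$, $In(x)\to In(x*q_0)$, $In(x)\to R(x)$; for each such $J$: $P^J(e)$ and $P^J(x)\to P^J(x*q)$ for every $q\in J$; for each rule $q_1\to q_2$: $R((x*q_1)*y)\to R((x*q_2)*y)$; for $\forall_L J:q_1\to q_2$: $R((x*q_1)*y)\wedge P^J(x)\to R((x*q_2)*y)$; for $\forall_R J:q_1\to q_2$: $R((x*q_1)*y)\wedge P^J(y)\to R((x*q_2)*y)$; for $\forall_{LR} J:q_1\to q_2$: $R((x*q_1)*y)\wedge P^J(x)\wedge P^J(y)\to R((x*q_2)*y)$; for $\exists_L J:q_1\to q_2$ and each $q\in J$: $R((x*q_1)*y)\wedge x=(z*q)*w\to R((x*q_2)*y)$; for $\exists_R J:q_1\to q_2$ and each $q\in J$: $R((x*q_1)*y)\wedge y=(z*q)*w\to R((x*q_2)*y)$; for $\exists_{LR} J:q_1\to q_2$ and each $q\in J$: $R((x*q_1)*y)\wedge (x=(z*q)*w\vee y=(z*q)*w)\to R((x*q_2)*y)$. $\vdash$ is first-order derivability with equality. -}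

module Defs where

open import Data.Nat using (ℕ; zero; suc)
open import Data.Fin using (Fin)
open import Data.Fin.Subset using (Subset) renaming (_∈_ to _∈ₛ_)
open import Data.List using (List; []; _∷_; _++_; [_]; map)
open import Data.List.Membership.Propositional using (_∈_)
open import Data.List.Relation.Unary.All using (All)
open import Data.List.Relation.Unary.Any using (Any)
open import Data.Product using (Σ; _×_; ∃)
open import Relation.Binary.PropositionalEquality using (_≡_)
open import Relation.Binary.Construct.Closure.ReflexiveTransitive using (Star)

data Side : Set where
  L R LR : Side

data Guard (n : ℕ) : Set where
  all-g : Side → Subset n → Guard n
  ex-g  : Side → Subset n → Guard n

data Rule (n : ℕ) : Set where
  plain   : Fin n → Fin n → Rule n
  guarded : Guard n → Fin n → Fin n → Rule n

record System : Set where
  field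
    n     : ℕ
    rules : List (Rule n)
open System public

Config : ℕ → Set
Config n = List (Fin n)

-- (c̄ , i) ⊨ G, where c̄ = u ++ [c_i] ++ v (u = left part, v = right part)
Sat : ∀ {n} → Guard n → Config n → Config n → Set
Sat (all-g L  J) u v = All (_∈ₛ J) u
Sat (all-g R  J) u v = All (_∈ₛ J) v
Sat (all-g LR J) u v = All (_∈ₛ J) u × All (_∈ₛ J) v
Sat (ex-g  L  J) u v = Any (_∈ₛ J) u
Sat (ex-g  R  J) u v = Any (_∈ₛ J) v
Sat (ex-g  LR J) u v = Any (_∈ₛ J) u ⊎' Any (_∈ₛ J) v
  where open import Data.Sum using () renaming (_⊎_ to _⊎'_)

data Applies {n : ℕ} : Rule n → Config n → Config n → Fin n → Fin n → Set where
  ap-plain   : ∀ {q q' u v} → Applies (plain q q') u v q q'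
  ap-guarded : ∀ {G q q' u v} → Sat G u v → Applies (guarded G q q') u v q q'

data Step (P : System) : Config (n P) → Config (n P) → Set where
  step : ∀ {r u v q q'} → r ∈ rules P → Applies r u v q q' →
         Step P (u ++ [ q ] ++ v) (u ++ [ q' ] ++ v)

Reachable : (P : System) → Fin (n P) → Config (n P) → Set
Reachable P q₀ c = Σ (Config (n P)) λ c₀ → All (_≡ q₀) c₀ × Star (Step P) c₀ c

data Term (n : ℕ) : Set where
  var : ℕ → Term n
  st  : Fin n → Term n
  e   : Term n
  _⊛_ : Term n → Term n → Term n

data RelSym (n : ℕ) : Set where
  In  : RelSym n
  Rr  : RelSym n
  P^  : Subset n → RelSym n

infixr 4 _⇒_
infixr 5 _∨_
infixr 6 _∧_
infix 7 _≐_

data Formula (n : ℕ) : Set where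
  rel     : RelSym n → Term n → Formula n
  _≐_     : Term n → Term n → Formula n
  ⊥'      : Formula n
  _⇒_     : Formula n → Formula n → Formula n
  _∧_     : Formula n → Formula n → Formula n
  _∨_     : Formula n → Formula n → Formula n
  ∀'      : Formula n → Formula n
  ∃'      : Formula n → Formula n

module _ {n : ℕ} where

  liftR : (ℕ → ℕ) → ℕ → ℕ
  liftR ρ zero    = zero
  liftR ρ (suc k) = suc (ρ k)

  renT : (ℕ → ℕ) → Term n → Term n
  renT ρ (var k) = var (ρ k)
  renT ρ (st q)  = st q
  renT ρ e       = e
  renT ρ (s ⊛ t) = renT ρ s ⊛ renT ρ t

  renF : (ℕ → ℕ) → Formula n → Formula n
  renF ρ (rel r t) = rel r (renT ρ t)
  renF ρ (s ≐ t)   = renT ρ s ≐ renT ρ t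
  renF ρ ⊥'        = ⊥'
  renF ρ (φ ⇒ ψ)   = renF ρ φ ⇒ renF ρ ψ
  renF ρ (φ ∧ ψ)   = renF ρ φ ∧ renF ρ ψ
  renF ρ (φ ∨ ψ)   = renF ρ φ ∨ renF ρ ψ
  renF ρ (∀' φ)    = ∀' (renF (liftR ρ) φ)
  renF ρ (∃' φ)    = ∃' (renF (liftR ρ) φ)

  shiftF : Formula n → Formula n
  shiftF = renF suc

  liftS : (ℕ → Term n) → ℕ → Term n
  liftS σ zero    = var zero
  liftS σ (suc k) = renT suc (σ k)

  subT : (ℕ → Term n) → Term n → Term n
  subT σ (var k) = σ k
  subT σ (st q)  = st q
  subT σ e       = e
  subT σ (s ⊛ t) = subT σ s ⊛ subT σ t

  subF : (ℕ → Term n) → Formula n → Formula n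
  subF σ (rel r t) = rel r (subT σ t)
  subF σ (s ≐ t)   = subT σ s ≐ subT σ t
  subF σ ⊥'        = ⊥'
  subF σ (φ ⇒ ψ)   = subF σ φ ⇒ subF σ ψ
  subF σ (φ ∧ ψ)   = subF σ φ ∧ subF σ ψ
  subF σ (φ ∨ ψ)   = subF σ φ ∨ subF σ ψ
  subF σ (∀' φ)    = ∀' (subF (liftS σ) φ)
  subF σ (∃' φ)    = ∃' (subF (liftS σ) φ)

  single : Term n → ℕ → Term n
  single t zero    = t
  single t (suc k) = var k

  inst : Formula n → Term n → Formula n
  inst φ t = subF (single t) φ

  ¬' : Formula n → Formula n
  ¬' φ = φ ⇒ ⊥'

  infix 2 _∣_⊢_ _⊢_

  -- classical natural deduction with equality; Φ = set of (closed) axioms,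
  -- Γ = list of open assumptions
  data _∣_⊢_ (Φ : Formula n → Set) : List (Formula n) → Formula n → Set where
    axm  : ∀ {Γ φ} → Φ φ → Φ ∣ Γ ⊢ φ
    hyp  : ∀ {Γ φ} → φ ∈ Γ → Φ ∣ Γ ⊢ φ
    ⇒I   : ∀ {Γ φ ψ} → Φ ∣ φ ∷ Γ ⊢ ψ → Φ ∣ Γ ⊢ φ ⇒ ψ
    ⇒E   : ∀ {Γ φ ψ} → Φ ∣ Γ ⊢ φ ⇒ ψ → Φ ∣ Γ ⊢ φ → Φ ∣ Γ ⊢ ψ
    ∧I   : ∀ {Γ φ ψ} → Φ ∣ Γ ⊢ φ → Φ ∣ Γ ⊢ ψ → Φ ∣ Γ ⊢ φ ∧ ψ
    ∧E₁  : ∀ {Γ φ ψ} → Φ ∣ Γ ⊢ φ ∧ ψ → Φ ∣ Γ ⊢ φ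
    ∧E₂  : ∀ {Γ φ ψ} → Φ ∣ Γ ⊢ φ ∧ ψ → Φ ∣ Γ ⊢ ψ
    ∨I₁  : ∀ {Γ φ ψ} → Φ ∣ Γ ⊢ φ → Φ ∣ Γ ⊢ φ ∨ ψ
    ∨I₂  : ∀ {Γ φ ψ} → Φ ∣ Γ ⊢ ψ → Φ ∣ Γ ⊢ φ ∨ ψ
    ∨E   : ∀ {Γ φ ψ χ} → Φ ∣ Γ ⊢ φ ∨ ψ → Φ ∣ φ ∷ Γ ⊢ χ → Φ ∣ ψ ∷ Γ ⊢ χ → Φ ∣ Γ ⊢ χ
    ⊥E   : ∀ {Γ φ} → Φ ∣ Γ ⊢ ⊥' → Φ ∣ Γ ⊢ φ
    raa  : ∀ {Γ φ} → Φ ∣ ¬' φ ∷ Γ ⊢ ⊥' → Φ ∣ Γ ⊢ φ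
    ∀I   : ∀ {Γ φ} → Φ ∣ map shiftF Γ ⊢ φ → Φ ∣ Γ ⊢ ∀' φ
    ∀E   : ∀ {Γ φ} (t : Term n) → Φ ∣ Γ ⊢ ∀' φ → Φ ∣ Γ ⊢ inst φ t
    ∃I   : ∀ {Γ φ} (t : Term n) → Φ ∣ Γ ⊢ inst φ t → Φ ∣ Γ ⊢ ∃' φ
    ∃E   : ∀ {Γ φ ψ} → Φ ∣ Γ ⊢ ∃' φ → Φ ∣ φ ∷ map shiftF Γ ⊢ shiftF ψ → Φ ∣ Γ ⊢ ψ
    ≐refl  : ∀ {Γ} (t : Term n) → Φ ∣ Γ ⊢ t ≐ t
    ≐subst : ∀ {Γ s t} (φ : Formula n) → Φ ∣ Γ ⊢ s ≐ t → Φ ∣ Γ ⊢ inst φ s → Φ ∣ Γ ⊢ inst φ t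

  _⊢_ : (Formula n → Set) → Formula n → Set
  Φ ⊢ φ = Φ ∣ [] ⊢ φ

tc : ∀ {n} → Config n → Term n
tc []           = e
tc (c ∷ [])     = st c
tc (c ∷ d ∷ cs) = st c ⊛ tc (d ∷ cs)

-- variables of the universal closures (de Bruijn):
--   two-variable closures  ∀x ∀y :  x = var 1, y = var 0
--   four-variable closures ∀x ∀y ∀z ∀w : x = var 3, y = var 2, z = var 1, w = var 0
module _ {n : ℕ} where
  x₂ y₂ x₄ y₄ z₄ w₄ : Term n
  x₂ = var 1
  y₂ = var 0
  x₄ = var 3
  y₄ = var 2
  z₄ = var 1
  w₄ = var 0

  Rf : Term n → Formula n
  Rf = rel Rr

  Rat : Term n → Term n → Fin n → Formula n
  Rat x y q = Rf ((x ⊛ st q) ⊛ y)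

data Φ (P : System) (q₀ : Fin (n P)) : Formula (n P) → Set where
  ax-assoc : Φ P q₀ (∀' (∀' (∀' (((var 2 ⊛ var 1) ⊛ var 0) ≐ (var 2 ⊛ (var 1 ⊛ var 0))))))
  ax-unitl : Φ P q₀ (∀' ((e ⊛ var 0) ≐ var 0))
  ax-unitr : Φ P q₀ (∀' ((var 0 ⊛ e) ≐ var 0))
  ax-in-e  : Φ P q₀ (rel In e)
  ax-in-q₀ : Φ P q₀ (∀' (rel In (var 0) ⇒ rel In (var 0 ⊛ st q₀)))
  ax-in-R  : Φ P q₀ (∀' (rel In (var 0) ⇒ rel Rr (var 0)))
  ax-P-e   : ∀ {I J q₁ q₂} → guarded (all-g I J) q₁ q₂ ∈ rules P →
             Φ P q₀ (rel (P^ J) e)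
  ax-P-q   : ∀ {I J q₁ q₂ q} → guarded (all-g I J) q₁ q₂ ∈ rules P → q ∈ₛ J →
             Φ P q₀ (∀' (rel (P^ J) (var 0) ⇒ rel (P^ J) (var 0 ⊛ st q)))
  ax-plain : ∀ {q₁ q₂} → plain q₁ q₂ ∈ rules P →
             Φ P q₀ (∀' (∀' (Rat x₂ y₂ q₁ ⇒ Rat x₂ y₂ q₂)))
  ax-allL  : ∀ {J q₁ q₂} → guarded (all-g L J) q₁ q₂ ∈ rules P →
             Φ P q₀ (∀' (∀' (Rat x₂ y₂ q₁ ∧ rel (P^ J) x₂ ⇒ Rat x₂ y₂ q₂)))
  ax-allR  : ∀ {J q₁ q₂} → guarded (all-g R J) q₁ q₂ ∈ rules P →
             Φ P q₀ (∀' (∀' (Rat x₂ y₂ q₁ ∧ rel (P^ J) y₂ ⇒ Rat x₂ y₂ q₂)))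
  ax-allLR : ∀ {J q₁ q₂} → guarded (all-g LR J) q₁ q₂ ∈ rules P →
             Φ P q₀ (∀' (∀' (Rat x₂ y₂ q₁ ∧ rel (P^ J) x₂ ∧ rel (P^ J) y₂ ⇒ Rat x₂ y₂ q₂)))
  ax-exL   : ∀ {J q₁ q₂ q} → guarded (ex-g L J) q₁ q₂ ∈ rules P → q ∈ₛ J →
             Φ P q₀ (∀' (∀' (∀' (∀'
               (Rat x₄ y₄ q₁ ∧ x₄ ≐ ((z₄ ⊛ st q) ⊛ w₄) ⇒ Rat x₄ y₄ q₂)))))
  ax-exR   : ∀ {J q₁ q₂ q} → guarded (ex-g R J) q₁ q₂ ∈ rules P → q ∈ₛ J →
             Φ P q₀ (∀' (∀' (∀' (∀'
               (Rat x₄ y₄ q₁ ∧ y₄ ≐ ((z₄ ⊛ st q) ⊛ w₄) ⇒ Rat x₄ y₄ q₂)))))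
  ax-exLR  : ∀ {J q₁ q₂ q} → guarded (ex-g LR J) q₁ q₂ ∈ rules P → q ∈ₛ J →
             Φ P q₀ (∀' (∀' (∀' (∀'
               (Rat x₄ y₄ q₁ ∧ (x₄ ≐ ((z₄ ⊛ st q) ⊛ w₄) ∨ y₄ ≐ ((z₄ ⊛ st q) ⊛ w₄))
                 ⇒ Rat x₄ y₄ q₂)))))

module Submission where

-- Under the monoid axioms, t_{uv} = t_u * t_v is provable; in
--     particular t_{u q v} = (t_u * q) * t_v, which exposes any position of a
--     configuration in the shape the transition axioms expect.
--   * Closure.  If X(e) and X(x) → X(x * q) for all q ∈ S are provable, then
--     X(t_w) is provable for every w ∈ S*.  This yields In(t_c̄₀) for the
--     initial configuration and P^J(t_u) whenever all letters of u lie in J.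
--   * Transitions.  Each rule application is simulated by the corresponding
--     axiom; an ∃-guard is witnessed by splitting the context at a letter of J.

open import Defs
open import Data.Fin using (Fin)
open import Data.Nat using (ℕ; zero; suc)
open import Data.Fin.Subset using (Subset) renaming (_∈_ to _∈ₛ_)
open import Data.List using ([]; _∷_; _++_; [_])
open import Data.List.Properties using (++-assoc; ++-identityʳ)
open import Data.List.Membership.Propositional using (_∈_; find)
open import Data.List.Membership.Propositional.Properties using (∈-∃++)
open import Data.List.Relation.Unary.All using (All; []; _∷_)
open import Data.List.Relation.Unary.Any using (Any)
open import Data.Product using (Σ; _×_; _,_)
open import Data.Sum using (_⊎_; inj₁; inj₂)
import Data.Sum as Sum
open import Level using (0ℓ)
open import Relation.Binary.Bundles using (Setoid)
import Relation.Binary.Reasoning.Setoid as SetoidReasoning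
open import Relation.Binary.PropositionalEquality
  using (_≡_; refl; sym; trans; cong; cong₂; subst; subst₂; module ≡-Reasoning)
open import Relation.Binary.Construct.Closure.ReflexiveTransitive using (Star; ε; _◅_)

module _ {n : ℕ} where

  wk : Term n → Term n
  wk = renT suc

  wkⁿ : ℕ → Term n → Term n
  wkⁿ zero    t = t
  wkⁿ (suc k) t = wk (wkⁿ k t)

  liftSⁿ : ℕ → (ℕ → Term n) → ℕ → Term n
  liftSⁿ zero    σ = σ
  liftSⁿ (suc k) σ = liftS (liftSⁿ k σ)

  sub-lift-wk : (σ : ℕ → Term n) (t : Term n) → subT (liftS σ) (wk t) ≡ wk (subT σ t)
  sub-lift-wk σ (var k) = refl
  sub-lift-wk σ (st q)  = refl
  sub-lift-wk σ e       = refl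
  sub-lift-wk σ (s ⊛ t) = cong₂ _⊛_ (sub-lift-wk σ s) (sub-lift-wk σ t)

  inst-wk : (s t : Term n) → subT (single s) (wk t) ≡ t
  inst-wk s (var k) = refl
  inst-wk s (st q)  = refl
  inst-wk s e       = refl
  inst-wk s (t ⊛ u) = cong₂ _⊛_ (inst-wk s t) (inst-wk s u)

  inst-wkⁿ : (k : ℕ) (s t : Term n) →
             subT (liftSⁿ k (single s)) (wkⁿ (suc k) t) ≡ wkⁿ k t
  inst-wkⁿ zero    s t = inst-wk s t
  inst-wkⁿ (suc k) s t =
    trans (sub-lift-wk (liftSⁿ k (single s)) (wkⁿ (suc k) t)) (cong wk (inst-wkⁿ k s t))

  -- These are the shapes produced by
  -- repeated ∀-elimination on the three- and four-variable axioms.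
  inst-wk² : (z w t : Term n) →
             subT (single w) (subT (liftS (single z)) (wkⁿ 2 t)) ≡ t
  inst-wk² z w t = begin
    subT (single w) (subT (liftS (single z)) (wkⁿ 2 t)) ≡⟨ cong (subT (single w)) (inst-wkⁿ 1 z t) ⟩
    subT (single w) (wk t)                              ≡⟨ inst-wk w t ⟩
    t                                                   ∎
    where open ≡-Reasoning

  inst-wk³ : (y z w t : Term n) →
             subT (single w) (subT (liftS (single z)) (subT (liftS (liftS (single y))) (wkⁿ 3 t))) ≡ t
  inst-wk³ y z w t = begin
    subT (single w) (subT (liftS (single z)) (subT (liftS (liftS (single y))) (wkⁿ 3 t)))
      ≡⟨ cong (λ r → subT (single w) (subT (liftS (single z)) r)) (inst-wkⁿ 2 y t) ⟩
    subT (single w) (subT (liftS (single z)) (wkⁿ 2 t))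
      ≡⟨ inst-wk² z w t ⟩
    t ∎
    where open ≡-Reasoning

module ProvableEquality {n : ℕ} (Th : Formula n → Set) where

  -- Leibniz' law, up to definitional bookkeeping of the instantiated motive.
  leibniz : ∀ {s t A B} (φ : Formula n) → Th ⊢ s ≐ t →
            A ≡ inst φ s → inst φ t ≡ B → Th ⊢ A → Th ⊢ B
  leibniz φ s≐t A≡ ≡B h = subst (Th ⊢_) ≡B (≐subst φ s≐t (subst (Th ⊢_) A≡ h))

  ≐-sym : ∀ {s t} → Th ⊢ s ≐ t → Th ⊢ t ≐ s
  ≐-sym {s} {t} s≐t =
    leibniz (var 0 ≐ wk s) s≐t (cong (s ≐_) (sym (inst-wk s s))) (cong (t ≐_) (inst-wk t s))
      (≐refl s)

  ≐-trans : ∀ {r s t} → Th ⊢ r ≐ s → Th ⊢ s ≐ t → Th ⊢ r ≐ t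
  ≐-trans {r} {s} {t} r≐s s≐t =
    leibniz (wk r ≐ var 0) s≐t (cong (_≐ s) (sym (inst-wk s r))) (cong (_≐ t) (inst-wk t r)) r≐s

  -- Congruence of * in its right argument (the only one the proof needs).
  ⊛-congʳ : ∀ {s t} (u : Term n) → Th ⊢ s ≐ t → Th ⊢ (u ⊛ s) ≐ (u ⊛ t)
  ⊛-congʳ {s} {t} u s≐t =
    leibniz (wk (u ⊛ s) ≐ (wk u ⊛ var 0)) s≐t
      (cong₂ _≐_ (sym (inst-wk s (u ⊛ s))) (cong (_⊛ s) (sym (inst-wk s u))))
      (cong₂ _≐_ (inst-wk t (u ⊛ s)) (cong (_⊛ t) (inst-wk t u)))
      (≐refl (u ⊛ s))

  transport : ∀ {s t} (X : RelSym n) → Th ⊢ s ≐ t → Th ⊢ rel X s → Th ⊢ rel X t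
  transport X = ≐subst (rel X (var 0))

  ≐-setoid : Setoid 0ℓ 0ℓ
  ≐-setoid = record
    { Carrier       = Term n
    ; _≈_           = λ s t → Th ⊢ s ≐ t
    ; isEquivalence = record { refl = ≐refl _ ; sym = ≐-sym ; trans = ≐-trans }
    }

  module ≐-Reasoning = SetoidReasoning ≐-setoid

module Words {n : ℕ} (Th : Formula n → Set)
  (assoc-ax : Th (∀' (∀' (∀' (((var 2 ⊛ var 1) ⊛ var 0) ≐ (var 2 ⊛ (var 1 ⊛ var 0)))))))
  (unitˡ-ax : Th (∀' ((e ⊛ var 0) ≐ var 0)))
  (unitʳ-ax : Th (∀' ((var 0 ⊛ e) ≐ var 0)))
  where

  open ProvableEquality Th

  ⊛-assoc : (a b c : Term n) → Th ⊢ ((a ⊛ b) ⊛ c) ≐ (a ⊛ (b ⊛ c))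
  ⊛-assoc a b c =
    subst₂ (λ a′ b′ → Th ⊢ ((a′ ⊛ b′) ⊛ c) ≐ (a′ ⊛ (b′ ⊛ c))) (inst-wk² b c a) (inst-wk c b)
      (∀E c (∀E b (∀E a (axm assoc-ax))))

  tc-++ : (u w : Config n) → Th ⊢ tc (u ++ w) ≐ (tc u ⊛ tc w)
  tc-++ []           w       = ≐-sym (∀E (tc w) (axm unitˡ-ax))
  tc-++ (a ∷ [])     []      = ≐-sym (∀E (st a) (axm unitʳ-ax))
  tc-++ (a ∷ [])     (b ∷ w) = ≐refl _
  tc-++ (a ∷ b ∷ u)  w       = begin
    st a ⊛ tc (b ∷ u ++ w)        ≈⟨ ⊛-congʳ (st a) (tc-++ (b ∷ u) w) ⟩
    st a ⊛ (tc (b ∷ u) ⊛ tc w)    ≈⟨ ⊛-assoc (st a) (tc (b ∷ u)) (tc w) ⟨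
    (st a ⊛ tc (b ∷ u)) ⊛ tc w    ∎
    where open ≐-Reasoning

  -- t_{u q v} = (t_u * q) * t_v: the shape of the transition axioms.
  tc-focus : (u : Config n) (q : Fin n) (v : Config n) →
             Th ⊢ tc (u ++ q ∷ v) ≐ ((tc u ⊛ st q) ⊛ tc v)
  tc-focus u q v = begin
    tc (u ++ q ∷ v)          ≈⟨ tc-++ u (q ∷ v) ⟩
    tc u ⊛ tc (q ∷ v)        ≈⟨ ⊛-congʳ (tc u) (tc-++ [ q ] v) ⟩
    tc u ⊛ (st q ⊛ tc v)     ≈⟨ ⊛-assoc (tc u) (st q) (tc v) ⟨
    (tc u ⊛ st q) ⊛ tc v     ∎
    where open ≐-Reasoning

  word-closure : (X : RelSym n) (S : Fin n → Set) →
                 Th ⊢ rel X e →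
                 (∀ {q} → S q → Th ⊢ ∀' (rel X (var 0) ⇒ rel X (var 0 ⊛ st q))) →
                 (w : Config n) → All S w → Th ⊢ rel X (tc w)
  word-closure X S base grow w Sw = extend [] w base Sw
    where
    extend : (u w : Config n) → Th ⊢ rel X (tc u) → All S w → Th ⊢ rel X (tc (u ++ w))
    extend u []      Xu []         = subst (λ c → Th ⊢ rel X (tc c)) (sym (++-identityʳ u)) Xu
    extend u (a ∷ w) Xu (Sa ∷ Sw)  =
      subst (λ c → Th ⊢ rel X (tc c)) (++-assoc u [ a ] w)
        (extend (u ++ [ a ]) w (transport X (≐-sym (tc-++ u [ a ])) (⇒E (∀E (tc u) (grow Sa)) Xu)) Sw)

module Simulation (P : System) (q₀ : Fin (n P)) where

  Th : Formula (n P) → Set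
  Th = Φ P q₀

  open ProvableEquality Th
  open Words Th ax-assoc ax-unitl ax-unitr

  initial : (c₀ : Config (n P)) → All (_≡ q₀) c₀ → Th ⊢ rel Rr (tc c₀)
  initial c₀ c₀∈q₀* = ⇒E (∀E (tc c₀) (axm ax-in-R)) (word-closure In (_≡ q₀) (axm ax-in-e) in-q₀ c₀ c₀∈q₀*)
    where
    in-q₀ : ∀ {q} → q ≡ q₀ → Th ⊢ ∀' (rel In (var 0) ⇒ rel In (var 0 ⊛ st q))
    in-q₀ refl = axm ax-in-q₀

  universal-guard : ∀ {I J q₁ q₂} → guarded (all-g I J) q₁ q₂ ∈ rules P →
                    (u : Config (n P)) → All (_∈ₛ J) u → Th ⊢ rel (P^ J) (tc u)
  universal-guard r∈T = word-closure (P^ _) (_∈ₛ _) (axm (ax-P-e r∈T)) (λ q∈J → axm (ax-P-q r∈T q∈J))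

  Witness : Subset (n P) → Term (n P) → Set
  Witness J t = Σ (Config (n P)) λ a → Σ (Fin (n P)) λ p → Σ (Config (n P)) λ b →
                p ∈ₛ J × (Th ⊢ t ≐ ((tc a ⊛ st p) ⊛ tc b))

  existential-guard : ∀ {J} (u : Config (n P)) → Any (_∈ₛ J) u → Witness J (tc u)
  existential-guard u some with find some
  ... | p , p∈u , p∈J with ∈-∃++ p∈u
  ...   | a , b , refl = a , p , b , p∈J , tc-focus a p b

  universal-rule : ∀ {I J u v q q′} → guarded (all-g I J) q q′ ∈ rules P → Sat (all-g I J) u v →
                   Th ⊢ Rat (tc u) (tc v) q → Th ⊢ Rat (tc u) (tc v) q′
  universal-rule {L} {J} {u} {v} {q} {q′} r∈T u∈J* h =
    ⇒E (subst (λ x → Th ⊢ Rat x (tc v) q ∧ rel (P^ J) x ⇒ Rat x (tc v) q′) (inst-wk (tc v) (tc u))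
         (∀E (tc v) (∀E (tc u) (axm (ax-allL r∈T)))))
       (∧I h (universal-guard r∈T u u∈J*))
  universal-rule {R} {J} {u} {v} {q} {q′} r∈T v∈J* h =
    ⇒E (subst (λ x → Th ⊢ Rat x (tc v) q ∧ rel (P^ J) (tc v) ⇒ Rat x (tc v) q′) (inst-wk (tc v) (tc u))
         (∀E (tc v) (∀E (tc u) (axm (ax-allR r∈T)))))
       (∧I h (universal-guard r∈T v v∈J*))
  universal-rule {LR} {J} {u} {v} {q} {q′} r∈T (u∈J* , v∈J*) h =
    ⇒E (subst (λ x → Th ⊢ Rat x (tc v) q ∧ rel (P^ J) x ∧ rel (P^ J) (tc v) ⇒ Rat x (tc v) q′)
              (inst-wk (tc v) (tc u))
         (∀E (tc v) (∀E (tc u) (axm (ax-allLR r∈T)))))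
       (∧I h (∧I (universal-guard r∈T u u∈J*) (universal-guard r∈T v v∈J*)))

  subst₃ : ∀ {A : Set} (F : A → A → A → Set) {a a′ b b′ c c′} →
           a ≡ a′ → b ≡ b′ → c ≡ c′ → F a b c → F a′ b′ c′
  subst₃ F refl refl refl h = h

  existential-rule : ∀ {I J u v q q′} → guarded (ex-g I J) q q′ ∈ rules P → Sat (ex-g I J) u v →
                     Th ⊢ Rat (tc u) (tc v) q → Th ⊢ Rat (tc u) (tc v) q′
  existential-rule {L} {J} {u} {v} {q} {q′} r∈T J-in-u h with existential-guard u J-in-u
  ... | a , p , b , p∈J , u≐apb =
    ⇒E (subst₃ (λ x y z → Th ⊢ Rat x y q ∧ x ≐ ((z ⊛ st p) ⊛ tc b) ⇒ Rat x y q′)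
           (inst-wk³ (tc v) (tc a) (tc b) (tc u)) (inst-wk² (tc a) (tc b) (tc v)) (inst-wk (tc b) (tc a))
           (∀E (tc b) (∀E (tc a) (∀E (tc v) (∀E (tc u) (axm (ax-exL r∈T p∈J)))))))
       (∧I h u≐apb)
  existential-rule {R} {J} {u} {v} {q} {q′} r∈T J-in-v h with existential-guard v J-in-v
  ... | a , p , b , p∈J , v≐apb =
    ⇒E (subst₃ (λ x y z → Th ⊢ Rat x y q ∧ y ≐ ((z ⊛ st p) ⊛ tc b) ⇒ Rat x y q′)
           (inst-wk³ (tc v) (tc a) (tc b) (tc u)) (inst-wk² (tc a) (tc b) (tc v)) (inst-wk (tc b) (tc a))
           (∀E (tc b) (∀E (tc a) (∀E (tc v) (∀E (tc u) (axm (ax-exR r∈T p∈J)))))))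
       (∧I h v≐apb)
  existential-rule {LR} {J} {u} {v} {q} {q′} r∈T J-in-u-or-v h =
    fire (Sum.map (existential-guard u) (existential-guard v) J-in-u-or-v)
    where
    axiom : ∀ {a p b} → p ∈ₛ J →
            Th ⊢ Rat (tc u) (tc v) q ∧ (tc u ≐ ((tc a ⊛ st p) ⊛ tc b) ∨ tc v ≐ ((tc a ⊛ st p) ⊛ tc b))
                   ⇒ Rat (tc u) (tc v) q′
    axiom {a} {p} {b} p∈J =
      subst₃ (λ x y z → Th ⊢ Rat x y q ∧ (x ≐ ((z ⊛ st p) ⊛ tc b) ∨ y ≐ ((z ⊛ st p) ⊛ tc b)) ⇒ Rat x y q′)
        (inst-wk³ (tc v) (tc a) (tc b) (tc u)) (inst-wk² (tc a) (tc b) (tc v)) (inst-wk (tc b) (tc a))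
        (∀E (tc b) (∀E (tc a) (∀E (tc v) (∀E (tc u) (axm (ax-exLR r∈T p∈J))))))

    fire : Witness J (tc u) ⊎ Witness J (tc v) → Th ⊢ Rat (tc u) (tc v) q′
    fire (inj₁ (a , p , b , p∈J , u≐apb)) = ⇒E (axiom p∈J) (∧I h (∨I₁ u≐apb))
    fire (inj₂ (a , p , b , p∈J , v≐apb)) = ⇒E (axiom p∈J) (∧I h (∨I₂ v≐apb))

  rule-sound : ∀ {r u v q q′} → r ∈ rules P → Applies r u v q q′ →
               Th ⊢ Rat (tc u) (tc v) q → Th ⊢ Rat (tc u) (tc v) q′
  rule-sound {u = u} {v} {q} {q′} r∈T ap-plain h =
    ⇒E (subst (λ x → Th ⊢ Rat x (tc v) q ⇒ Rat x (tc v) q′) (inst-wk (tc v) (tc u))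
         (∀E (tc v) (∀E (tc u) (axm (ax-plain r∈T))))) h
  rule-sound {guarded (all-g I J) _ _} r∈T (ap-guarded holds) = universal-rule r∈T holds
  rule-sound {guarded (ex-g I J) _ _}  r∈T (ap-guarded holds) = existential-rule r∈T holds

  step-sound : ∀ {c c′} → Step P c c′ → Th ⊢ rel Rr (tc c) → Th ⊢ rel Rr (tc c′)
  step-sound (step {u = u} {v} {q} {q′} r∈T ap) h =
    transport Rr (≐-sym (tc-focus u q′ v))
      (rule-sound r∈T ap (transport Rr (tc-focus u q v) h))

  run-sound : ∀ {c c′} → Star (Step P) c c′ → Th ⊢ rel Rr (tc c) → Th ⊢ rel Rr (tc c′)
  run-sound ε        h = h
  run-sound (s ◅ ss) h = run-sound ss (step-sound s h)

proposition2 : (P : System) (q₀ : Fin (n P)) (c : Config (n P)) →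
    Reachable P q₀ c → Φ P q₀ ⊢ rel Rr (tc c)
proposition2 P q₀ c (c₀ , c₀∈q₀* , run) = run-sound run (initial c₀ c₀∈q₀*)
  where open Simulation P q₀
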